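{- For all $s<t$ in $\omega$ and ordinals $1\le\gamma<\xi\le\omega^\eta$: if $\langle\rangle\neq\nabla^\xi_s\subseteq\nabla^\xi_t$, then $\nabla^\gamma_s\subseteq\nabla^\gamma_t$.
   Context: $\subseteq$ is the prefix relation, $\langle\rangle$ the empty string. Fix an effective enumeration $\varphi_0,\varphi_1,\dots$ of Turing functionals; for finite $\sigma$, $\varphi_e^\sigma(i)\downarrow$ means convergence with oracle $\sigma$ within $|\sigma|$ steps; strings are coded by numbers. $J:\omega^{<\omega}\to\omega^{<\omega}$: given $\sigma$, let $t_{ -1}=1$, $t_i=t_{i-1}+1$ if $\varphi_i^\sigma(i)\uparrow$, else $t_i=\max\{t_{i-1}+1,\mu t(\varphi_i^{\sigma\restriction t}(i)\downarrow)\}$; $J(\sigma)=\langle\sigma\restriction t_0,\dots,\sigma\restriction t_k\rangle$ with $k$ least such that $t_{k+1}>|\sigma|$ ($\langle\rangle$ if $t_0>|\sigma|$). $\eta$ is a computable ordinal (computable presentation, computable successor); each nonzero $\alpha\le\eta$ has a fixed uniformly computable characteristic sequence $\alpha[0]\le\alpha[1]\le\cdots<\alpha$ with $\lim_n(\alpha[n]+1)=\alpha$. Recursively: $J^{\omega^0}=J$; for $\alpha>0$, $J^{\omega^\alpha}_n=J^{\omega^{\alpha[n-1]}}\circ\cdots\circ J^{\omega^{\alpha[0]}}$ ($J^{\omega^\alpha}_0=\mathrm{id}$), $J^{\omega^\alpha}(\sigma)=\langle J^{\omega^\alpha}_1(\sigma)(0),\dots,J^{\omega^\alpha}_{m-1}(\sigma)(0)\rangle$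 with $m$ least such that $J^{\omega^\alpha}_m(\sigma)=\langle\rangle$. $T_\beta=\{\langle n_0,\dots,n_k\rangle:\beta[n_0]\cdots[n_k]\text{ exists}\}$; $J^{\omega^\beta}_{\langle\rangle}=J^{\omega^\beta}$, $J^{\omega^\beta}_{\langle n_0,\dots,n_k\rangle}=J^{\omega^{\beta[n_0]}}_{\langle n_1,\dots,n_k\rangle}\circ J^{\omega^\beta}_{n_0}$. Define $\eta\langle\rangle=\omega^\eta$ and $\eta\langle n_0,\dots,n_k\rangle=\sum_{i<n_0}\omega^{\eta[i]}+(\eta[n_0])\langle n_1,\dots,n_k\rangle$; every $\alpha$ with $1\le\alpha\le\omega^\eta$ is $\eta\langle n_0,\dots,n_k\rangle$ for a unique $\langle n_0,\dots,n_k\rangle\in T_\eta$. Approximations: $\nabla^1_s$ is the string of $s$ zeros, and for $\alpha=\eta\langle n_0,\dots,n_k\rangle$, $\nabla^{1+\alpha}_s=J^{\omega^\eta}_{\langle n_0,\dots,n_k\rangle}(\nabla^1_s)$. -}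

module Defs where

open import Data.Nat using (ℕ; zero; suc; _⊔_; _≤ᵇ_)
open import Data.Bool using (Bool; true; false; if_then_else_)
open import Data.List using (List; []; _∷_; length; take; replicate)
open import Data.List.Relation.Binary.Prefix.Heterogeneous using (Prefix)
open import Data.Product using (_×_)
open import Data.Unit using (⊤)
open import Relation.Binary.PropositionalEquality using (_≡_)
open import Function using (id; _∘_)

Str : Set
Str = List ℕ

_⊑_ : Str → Str → Set
σ ⊑ τ = Prefix _≡_ σ τ

-- Abstract data fixed in the paper:
--   conv e σ i = true  means  φ_e^σ(i)↓ (convergence with oracle σ
--   within |σ| steps);  code : Str → ℕ  is the coding of strings.

Conv : Set
Conv = ℕ → Str → ℕ → Bool

ConvMonotone : Conv → Set
ConvMonotone conv = ∀ e σ τ i → σ ⊑ τ → conv e σ i ≡ true → conv e τ i ≡ true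

module JumpOp (conv : Conv) (code : Str → ℕ) where

  μsearch : ℕ → Str → ℕ → ℕ → ℕ
  μsearch i σ t zero = t
  μsearch i σ t (suc k) = if conv i (take t σ) i then t else μsearch i σ (suc t) k

  μt : ℕ → Str → ℕ
  μt i σ = μsearch i σ 0 (suc (length σ))

  tNext : ℕ → Str → ℕ → ℕ
  tNext i σ prev = if conv i σ i then suc prev ⊔ μt i σ else suc prev

  Jgo : Str → ℕ → ℕ → ℕ → List ℕ
  Jgo σ i prev zero = []
  Jgo σ i prev (suc k) =
    if tNext i σ prev ≤ᵇ length σ
    then code (take (tNext i σ prev) σ) ∷ Jgo σ (suc i) (tNext i σ prev) k
    else []

  -- t_{-1} = 1; since t_i ≥ i + 2, at most |σ| entries
  J : Str → Str
  J σ = Jgo σ 0 1 (length σ)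

-- Ordinals ≤ η given together with their characteristic sequences:
-- zero, or  lim f  denoting the nonzero ordinal α with α[n] = f n
-- (its value is  lim_n (α[n] + 1) = sup_n (f n + 1)).

data Ord : Set where
  zero : Ord
  lim  : (ℕ → Ord) → Ord

data Brw : Set where
  bz : Brw
  bs : Brw → Brw
  bl : (ℕ → Brw) → Brw

infix 4 _≤o_ _<o_ _≈o_

data _≤o_ : Brw → Brw → Set where
  ≤-zero     : ∀ {x} → bz ≤o x
  ≤-trans    : ∀ {x y z} → x ≤o y → y ≤o z → x ≤o z
  ≤-succ     : ∀ {x y} → x ≤o y → bs x ≤o bs y
  ≤-cocone   : ∀ {x} f k → x ≤o f k → x ≤o bl f
  ≤-limiting : ∀ {x} f → (∀ k → f k ≤o x) → bl f ≤o x

_<o_ : Brw → Brw → Set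
x <o y = bs x ≤o y

_≈o_ : Brw → Brw → Set
x ≈o y = (x ≤o y) × (y ≤o x)

infixl 6 _+o_
_+o_ : Brw → Brw → Brw
x +o bz = x
x +o bs y = bs (x +o y)
x +o bl f = bl (λ n → x +o f n)

_·ℕ_ : Brw → ℕ → Brw
x ·ℕ zero = bz
x ·ℕ suc n = (x ·ℕ n) +o x

ω^ : Brw → Brw
ω^ bz = bs bz
ω^ (bs x) = bl (λ n → ω^ x ·ℕ n)
ω^ (bl f) = bl (λ n → ω^ (f n))

⟦_⟧ : Ord → Brw
⟦ zero ⟧ = bz
⟦ lim f ⟧ = bl (λ n → bs ⟦ f n ⟧)

data InT : Ord → List ℕ → Set where
  here : ∀ {α} → InT α []
  step : ∀ {f n ns} → InT (f n) ns → InT (lim f) (n ∷ ns)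

subAt : Ord → List ℕ → Ord
subAt α [] = α
subAt zero (_ ∷ _) = zero
subAt (lim f) (n ∷ ns) = subAt (f n) ns

data _≅_ : Ord → Ord → Set where
  zero≅ : zero ≅ zero
  lim≅  : ∀ {f g} → (∀ n → f n ≅ g n) → lim f ≅ lim g

MonoNode : Ord → Set
MonoNode zero = ⊤
MonoNode (lim f) = ∀ n → ⟦ f n ⟧ ≤o ⟦ f (suc n) ⟧

-- η is a system of characteristic sequences for the ordinals ≤ η:
-- every reachable sequence is nondecreasing, and the sequence is a
-- function of the ordinal (equal ordinals carry the same sequence)
IsSystem : Ord → Set
IsSystem η =
  (∀ p → InT η p → MonoNode (subAt η p)) ×
  (∀ p q → InT η p → InT η q → ⟦ subAt η p ⟧ ≈o ⟦ subAt η q ⟧ → subAt η p ≅ subAt η q)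

psum : (ℕ → Ord) → ℕ → Brw
psum f zero = bz
psum f (suc n) = psum f n +o ω^ ⟦ f n ⟧

addrVal : Ord → List ℕ → Brw
addrVal α [] = ω^ ⟦ α ⟧
addrVal zero (_ ∷ _) = bz
addrVal (lim f) (n ∷ ns) = psum f n +o addrVal (f n) ns

module Iterated (conv : Conv) (code : Str → ℕ) where
  open JumpOp conv code public

  iterN : (ℕ → Str → Str) → ℕ → Str → Str
  iterN g zero = id
  iterN g (suc n) = g n ∘ iterN g n

  -- given cur = J_n(σ), output ⟨J_{n+1}(σ)(0), …⟩ until some J_m(σ) = ⟨⟩
  loop : (ℕ → Str → Str) → ℕ → Str → ℕ → Str
  loop g n [] k = []
  loop g n (x ∷ xs) zero = []
  loop g n (x ∷ xs) (suc k) with g n (x ∷ xs)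
  ... | [] = []
  ... | y ∷ ys = y ∷ loop g (suc n) (y ∷ ys) k

  -- J^{ω^α}  (fuel |σ|+1 suffices: lengths strictly decrease)
  Jω : Ord → Str → Str
  Jω zero = J
  Jω (lim f) σ = loop (λ n → Jω (f n)) 0 σ (suc (length σ))

  Jωn : Ord → ℕ → Str → Str
  Jωn zero n = id
  Jωn (lim f) n = iterN (λ k → Jω (f k)) n

  Jaddr : Ord → List ℕ → Str → Str
  Jaddr α [] = Jω α
  Jaddr zero (_ ∷ _) = id
  Jaddr (lim f) (n ∷ ns) = Jaddr (f n) ns ∘ Jωn (lim f) n

  -- superscripts ξ ≥ 1 of ∇: ξ = 1, or ξ = 1 + η⟨a⟩ with a ∈ T_η
  data Idx (η : Ord) : Set where
    one     : Idx η
    oneplus : (a : List ℕ) → InT η a → Idx η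

  idxVal : ∀ {η} → Idx η → Brw
  idxVal one = bs bz
  idxVal {η} (oneplus a _) = bs bz +o addrVal η a

  ∇ : ∀ {η} → Idx η → ℕ → Str
  ∇ one s = replicate s 0
  ∇ {η} (oneplus a _) s = Jaddr η a (replicate s 0)

-- Every J^{ω^α} is jump-like: it sends exactly the strings of length ≤ 1
-- to ⟨⟩, it shortens nonempty strings, and a nonempty J^{ω^α}(σ) ⊑ J^{ω^α}(τ)
-- forces σ ⊑ τ.  For J this holds because the last entry of J(σ) codes σ
-- itself while every entry of J(τ) codes a prefix of τ.  For a limit α, the
-- last entry of J^{ω^α}(σ) is the whole of the last nonempty iterate
-- J^{ω^α}_m(σ), so J^{ω^α}_m(σ) ⊑ J^{ω^α}_m(τ); reflection then runs down
-- through the earlier iterates, and the later iterates of σ are ⟨⟩.  Hence a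
-- nonempty ∇^ξ_s ⊑ ∇^ξ_t propagates to every address lexicographically below
-- the address of ξ, and γ < ξ puts the address of γ there.

module Submission where

open import Defs
open import Data.Nat using (ℕ; zero; suc; _+_; _≤_; _<_; _≤‴_; ≤‴-refl; ≤‴-step; z≤n; s≤s; _≤ᵇ_)
import Data.Nat.Properties as ℕ
open import Data.Bool using (true; false)
open import Data.List using (List; []; _∷_; length; take)
open import Data.List.Properties using (take-all)
open import Data.List.Membership.Propositional using (_∈_)
open import Data.List.Relation.Unary.Any using (here; there)
open import Data.List.Relation.Binary.Prefix.Heterogeneous using ([]; _∷_)
open import Data.List.Relation.Binary.Prefix.Heterogeneous.Properties using (replicate⁺)
open import Data.Product using (∃; ∃₂; _×_; _,_; proj₂)
open import Data.Sum using (_⊎_; inj₁; inj₂)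
import Data.Sum as Sum
open import Data.Empty using (⊥-elim)
open import Function using (_∘_)
open import Function.Definitions using (Injective)
open import Relation.Nullary using (¬_)
open import Relation.Nullary.Reflects using (ofʸ; ofⁿ)
open import Relation.Binary.PropositionalEquality
  using (_≡_; _≢_; refl; sym; trans; cong; subst; subst₂)
open import Relation.Binary.Definitions using (tri<; tri≈; tri>)
import Relation.Binary.Reasoning.Base.Single as SingleReasoning

≤-ascend : {P : ℕ → Set} → (∀ {k} → P k → P (suc k)) → ∀ {m n} → m ≤ n → P m → P n
≤-ascend {P} next m≤n = go (ℕ.≤⇒≤‴ m≤n)
  where
    go : ∀ {m n} → m ≤‴ n → P m → P n
    go ≤‴-refl p = p
    go (≤‴-step m<n) p = go m<n (next p)

≤-descend : {P : ℕ → Set} → (∀ {k} → P (suc k) → P k) → ∀ {m n} → m ≤ n → P n → P m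
≤-descend {P} next m≤n = go (ℕ.≤⇒≤‴ m≤n)
  where
    go : ∀ {m n} → m ≤‴ n → P n → P m
    go ≤‴-refl p = p
    go (≤‴-step m<n) p = next (go m<n p)

-- Unlike _≤o_, which has a transitivity constructor, this presentation of
-- the order can be inverted; that is what makes _≺_ provably irreflexive.
infix 4 _≼_ _≺_
data _≼_ : Brw → Brw → Set
data _≺_ : Brw → Brw → Set

data _≼_ where
  bz≼ : ∀ {y} → bz ≼ y
  bs≼ : ∀ {x y} → x ≺ y → bs x ≼ y
  bl≼ : ∀ {f y} → (∀ k → f k ≼ y) → bl f ≼ y

data _≺_ where
  ≺bs : ∀ {x y} → x ≼ y → x ≺ bs y
  ≺bl : ∀ {x f} k → x ≺ f k → x ≺ bl f

s≼s : ∀ {x y} → x ≼ y → bs x ≼ bs y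
s≼s x≼y = bs≼ (≺bs x≼y)

≼-cocone : ∀ {x f} k → x ≼ f k → x ≼ bl f
≼-cocone k bz≼ = bz≼
≼-cocone k (bs≼ x≺fk) = bs≼ (≺bl k x≺fk)
≼-cocone k (bl≼ g≼fk) = bl≼ (λ j → ≼-cocone k (g≼fk j))

≺⇒≼ : ∀ {x y} → x ≺ y → x ≼ y
≼-bsʳ : ∀ {x y} → x ≼ y → x ≼ bs y

≺⇒≼ (≺bs x≼y) = ≼-bsʳ x≼y
≺⇒≼ (≺bl k x≺fk) = ≼-cocone k (≺⇒≼ x≺fk)

≼-bsʳ bz≼ = bz≼
≼-bsʳ (bs≼ x≺y) = s≼s (≺⇒≼ x≺y)
≼-bsʳ (bl≼ f≼y) = bl≼ (λ k → ≼-bsʳ (f≼y k))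

≼-refl : ∀ {x} → x ≼ x
≼-refl {bz} = bz≼
≼-refl {bs x} = s≼s ≼-refl
≼-refl {bl f} = bl≼ (λ k → ≼-cocone k ≼-refl)

≼-trans : ∀ {x y z} → x ≼ y → y ≼ z → x ≼ z
≺-≼-trans : ∀ {x y z} → x ≺ y → y ≼ z → x ≺ z
≼-≺-trans : ∀ {x y z} → x ≼ y → y ≺ z → x ≺ z

≼-trans bz≼ _ = bz≼
≼-trans (bs≼ x≺y) y≼z = bs≼ (≺-≼-trans x≺y y≼z)
≼-trans (bl≼ f≼y) y≼z = bl≼ (λ k → ≼-trans (f≼y k) y≼z)

≺-≼-trans (≺bs x≼y) (bs≼ y≺z) = ≼-≺-trans x≼y y≺z
≺-≼-trans (≺bl k x≺fk) (bl≼ f≼z) = ≺-≼-trans x≺fk (f≼z k)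

≼-≺-trans x≼y (≺bs y≼z) = ≺bs (≼-trans x≼y y≼z)
≼-≺-trans x≼y (≺bl k y≺fk) = ≺bl k (≼-≺-trans x≼y y≺fk)

module ≼-Reasoning = SingleReasoning _≼_ ≼-refl ≼-trans

≺-irrefl : ∀ {x} → ¬ x ≺ x
≺-irrefl {bs x} (≺bs (bs≼ x≺x)) = ≺-irrefl x≺x
≺-irrefl {bl f} (≺bl k lim≺fk) = ≺-irrefl (≼-≺-trans (≼-cocone k ≼-refl) lim≺fk)

≤o⇒≼ : ∀ {x y} → x ≤o y → x ≼ y
≤o⇒≼ ≤-zero = bz≼
≤o⇒≼ (≤-trans x≤y y≤z) = ≼-trans (≤o⇒≼ x≤y) (≤o⇒≼ y≤z)
≤o⇒≼ (≤-succ x≤y) = s≼s (≤o⇒≼ x≤y)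
≤o⇒≼ (≤-cocone f k x≤fk) = ≼-cocone k (≤o⇒≼ x≤fk)
≤o⇒≼ (≤-limiting f f≤x) = bl≼ (λ k → ≤o⇒≼ (f≤x k))

<o⇒≱ : ∀ {x y} → x <o y → ¬ y ≼ x
<o⇒≱ x<y y≼x with ≤o⇒≼ x<y
... | bs≼ x≺y = ≺-irrefl (≺-≼-trans x≺y y≼x)

x≼x+y : ∀ x y → x ≼ x +o y
x≼x+y x bz = ≼-refl
x≼x+y x (bs y) = ≼-bsʳ (x≼x+y x y)
x≼x+y x (bl f) = ≼-cocone 0 (x≼x+y x (f 0))

y≼x+y : ∀ x y → y ≼ x +o y
y≼x+y x bz = bz≼
y≼x+y x (bs y) = s≼s (y≼x+y x y)
y≼x+y x (bl f) = bl≼ (λ k → ≼-cocone k (y≼x+y x (f k)))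

+-monoʳ-≼ : ∀ c {x y} → x ≼ y → c +o x ≼ c +o y
+-monoʳ-≺ : ∀ c {x y} → x ≺ y → c +o x ≺ c +o y

+-monoʳ-≼ c {y = y} bz≼ = x≼x+y c y
+-monoʳ-≼ c (bs≼ x≺y) = bs≼ (+-monoʳ-≺ c x≺y)
+-monoʳ-≼ c (bl≼ f≼y) = bl≼ (λ k → +-monoʳ-≼ c (f≼y k))

+-monoʳ-≺ c (≺bs x≼y) = ≺bs (+-monoʳ-≼ c x≼y)
+-monoʳ-≺ c (≺bl k x≺fk) = ≺bl k (+-monoʳ-≺ c x≺fk)

+-monoˡ-≼ : ∀ {c c′} y → c ≼ c′ → c +o y ≼ c′ +o y
+-monoˡ-≼ bz c≼c′ = c≼c′
+-monoˡ-≼ (bs y) c≼c′ = s≼s (+-monoˡ-≼ y c≼c′)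
+-monoˡ-≼ (bl f) c≼c′ = bl≼ (λ k → ≼-cocone k (+-monoˡ-≼ (f k) c≼c′))

·ℕ-monoˡ-≼ : ∀ {x x′} k → x ≼ x′ → x ·ℕ k ≼ x′ ·ℕ k
·ℕ-monoˡ-≼ zero _ = bz≼
·ℕ-monoˡ-≼ {x} {x′} (suc k) x≼x′ =
  ≼-trans (+-monoˡ-≼ x (·ℕ-monoˡ-≼ k x≼x′)) (+-monoʳ-≼ (x′ ·ℕ k) x≼x′)

0≺ω^ : ∀ y → bz ≺ ω^ y
0≺ω^ bz = ≺bs bz≼
0≺ω^ (bs y) = ≺bl 1 (≺-≼-trans (0≺ω^ y) (y≼x+y bz (ω^ y)))
0≺ω^ (bl f) = ≺bl 0 (0≺ω^ (f 0))

ω^-mono-≼ : ∀ {x y} → x ≼ y → ω^ x ≼ ω^ y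
ω^·ℕ-≼-ω^ : ∀ {x y} → x ≺ y → ∀ k → ω^ x ·ℕ k ≼ ω^ y

ω^-mono-≼ {y = y} bz≼ = bs≼ (0≺ω^ y)
ω^-mono-≼ (bs≼ x≺y) = bl≼ (ω^·ℕ-≼-ω^ x≺y)
ω^-mono-≼ (bl≼ f≼y) = bl≼ (λ k → ω^-mono-≼ (f≼y k))

ω^·ℕ-≼-ω^ (≺bs x≼y) k = ≼-cocone k (·ℕ-monoˡ-≼ k (ω^-mono-≼ x≼y))
ω^·ℕ-≼-ω^ (≺bl j x≺fj) k = ≼-cocone j (ω^·ℕ-≼-ω^ x≺fj k)

≼-seq-mono : (h : ℕ → Brw) → (∀ k → h k ≼ h (suc k)) → ∀ {i j} → i ≤ j → h i ≼ h j
≼-seq-mono h next {i} i≤j =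
  ≤-ascend {λ j → h i ≼ h j} (λ {k} hi≼hk → ≼-trans hi≼hk (next k)) i≤j ≼-refl

HereditarilyMono : Ord → Set
HereditarilyMono α = ∀ p → InT α p → MonoNode (subAt α p)

HereditarilyMono-sub : ∀ {f} n → HereditarilyMono (lim f) → HereditarilyMono (f n)
HereditarilyMono-sub n mono p p∈ = mono (n ∷ p) (step p∈)

HereditarilyMono-seq : ∀ {f} → HereditarilyMono (lim f) → ∀ {i j} → i ≤ j → ⟦ f i ⟧ ≼ ⟦ f j ⟧
HereditarilyMono-seq {f} mono = ≼-seq-mono (λ k → ⟦ f k ⟧) (λ k → ≤o⇒≼ (mono [] here k))

psum-mono : ∀ f {i j} → i ≤ j → psum f i ≼ psum f j
psum-mono f = ≼-seq-mono (psum f) (λ k → x≼x+y (psum f k) (ω^ ⟦ f k ⟧))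

psum-≼-ω^·ℕ : ∀ f {x} j → (∀ {i} → i < j → ⟦ f i ⟧ ≼ x) → psum f j ≼ ω^ x ·ℕ j
psum-≼-ω^·ℕ f zero _ = bz≼
psum-≼-ω^·ℕ f {x} (suc j) f≼x =
  ≼-trans (+-monoˡ-≼ (ω^ ⟦ f j ⟧) (psum-≼-ω^·ℕ f j (f≼x ∘ ℕ.m<n⇒m<1+n)))
          (+-monoʳ-≼ (ω^ x ·ℕ j) (ω^-mono-≼ (f≼x ℕ.≤-refl)))

addrVal-≼-ω^ : ∀ {α a} → HereditarilyMono α → InT α a → addrVal α a ≼ ω^ ⟦ α ⟧
addrVal-≼-ω^ _ here = ≼-refl
addrVal-≼-ω^ {lim f} {n ∷ ns} mono (step a∈) = begin
  psum f n +o addrVal (f n) ns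
    ∼⟨ +-monoʳ-≼ (psum f n) (addrVal-≼-ω^ (HereditarilyMono-sub n mono) a∈) ⟩
  psum f (suc n)
    ∼⟨ psum-≼-ω^·ℕ f (suc n) (HereditarilyMono-seq mono ∘ ℕ.≤-pred) ⟩
  ω^ ⟦ f n ⟧ ·ℕ suc n
    ∼⟨ ≼-cocone n (≼-cocone (suc n) ≼-refl) ⟩
  ω^ ⟦ lim f ⟧ ∎
  where open ≼-Reasoning

-- The lexicographic order on addresses in which an address comes after all
-- of its extensions, matching η⟨b⟩ ≤ η⟨a⟩.
infix 4 _⊴_
data _⊴_ : List ℕ → List ℕ → Set where
  ⊴-[] : ∀ {b} → b ⊴ []
  ⊴-< : ∀ {m n ms ns} → m < n → m ∷ ms ⊴ n ∷ ns
  ⊴-∷ : ∀ {n ms ns} → ms ⊴ ns → n ∷ ms ⊴ n ∷ ns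

⊴-or-≼ : ∀ {α a b} → HereditarilyMono α → InT α a → InT α b →
         b ⊴ a ⊎ addrVal α a ≼ addrVal α b
⊴-or-≼ _ here _ = inj₁ ⊴-[]
⊴-or-≼ mono a∈@(step _) here = inj₂ (addrVal-≼-ω^ mono a∈)
⊴-or-≼ {lim f} mono (step {n = n} a∈) (step {n = m} b∈) with ℕ.<-cmp m n
... | tri< m<n _ _ = inj₁ (⊴-< m<n)
... | tri≈ _ refl _ =
  Sum.map ⊴-∷ (+-monoʳ-≼ (psum f n)) (⊴-or-≼ (HereditarilyMono-sub n mono) a∈ b∈)
... | tri> _ _ n<m = inj₂ (≼-trans
        (+-monoʳ-≼ (psum f n) (addrVal-≼-ω^ (HereditarilyMono-sub n mono) a∈))
        (≼-trans (psum-mono f n<m) (x≼x+y (psum f m) _)))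

infix 4 _⊑⁺_ _⊑₁_

_⊑⁺_ : Str → Str → Set
u ⊑⁺ v = u ≢ [] × u ⊑ v

_⊑₁_ : Str → Str → Set
u ⊑₁ v = length u ≤ 1 × u ⊑ v

take-⊑ : ∀ t (σ : Str) → take t σ ⊑ σ
take-⊑ zero σ = []
take-⊑ (suc t) [] = []
take-⊑ (suc t) (x ∷ σ) = refl ∷ take-⊑ t σ

∈-mono-⊑ : ∀ {x : ℕ} {u v} → x ∈ u → u ⊑ v → x ∈ v
∈-mono-⊑ (here refl) (refl ∷ _) = here refl
∈-mono-⊑ (there x∈u) (_ ∷ u⊑v) = there (∈-mono-⊑ x∈u u⊑v)

⊑⁺-∷ : ∀ {u v} → u ⊑⁺ v → ∃₂ λ z r → ∃ λ r′ → u ≡ z ∷ r × v ≡ z ∷ r′ × r ⊑ r′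
⊑⁺-∷ {[]} (u≢[] , _) = ⊥-elim (u≢[] refl)
⊑⁺-∷ {z ∷ r} (_ , refl ∷ r⊑r′) = z , r , _ , refl , refl , r⊑r′

short-∷-⊑ : ∀ {z : ℕ} {zs zs′} → length (z ∷ zs) ≤ 1 → (z ∷ zs) ⊑ (z ∷ zs′)
short-∷-⊑ {zs = []} _ = refl ∷ []
short-∷-⊑ {zs = _ ∷ _} (s≤s ())

record JumpLike (F : Str → Str) : Set where
  field
    short⇒[] : ∀ ρ → length ρ ≤ 1 → F ρ ≡ []
    []⇒short : ∀ ρ → F ρ ≡ [] → length ρ ≤ 1
    shrinks : ∀ ρ → ρ ≢ [] → length (F ρ) < length ρ
    reflects : ∀ {ρ τ} → F ρ ⊑⁺ F τ → ρ ⊑⁺ τ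

  []↦[] : F [] ≡ []
  []↦[] = short⇒[] [] z≤n

  ⊑₁-step : ∀ {u v} → u ⊑₁ v → F u ⊑₁ F v
  ⊑₁-step {u} (u≤1 , _) rewrite short⇒[] u u≤1 = z≤n , []

module JumpLikeJ (conv : Conv) (code : Str → ℕ) (code-inj : Injective _≡_ _≡_ code) where
  open JumpOp conv code

  μsearch-≤ : ∀ i σ {u} t k → conv i (take u σ) i ≡ true → t ≤ u → u < t + k →
              μsearch i σ t k ≤ u
  μsearch-≤ i σ {u} t zero _ t≤u u<t = ⊥-elim (ℕ.<⇒≱ (subst (u <_) (ℕ.+-identityʳ t) u<t) t≤u)
  μsearch-≤ i σ {u} t (suc k) conv-u t≤u u<t+k with conv i (take t σ) i in conv-t
  ... | true = t≤u
  ... | false with ℕ.m≤n⇒m<n∨m≡n t≤u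
  ...   | inj₁ t<u = μsearch-≤ i σ (suc t) k conv-u t<u (subst (u <_) (ℕ.+-suc t k) u<t+k)
  ...   | inj₂ refl with () ← trans (sym conv-u) conv-t

  prev<tNext : ∀ i σ prev → prev < tNext i σ prev
  prev<tNext i σ prev with conv i σ i
  ... | true = ℕ.m≤m⊔n (suc prev) (μt i σ)
  ... | false = ℕ.≤-refl

  tNext-≤ : ∀ i σ {prev} → prev < length σ → tNext i σ prev ≤ length σ
  tNext-≤ i σ prev<σ with conv i σ i in conv-σ
  ... | true = ℕ.⊔-lub prev<σ (μsearch-≤ i σ 0 (suc (length σ)) conv-whole z≤n ℕ.≤-refl)
    where
      conv-whole : conv i (take (length σ) σ) i ≡ true
      conv-whole rewrite take-all (length σ) σ ℕ.≤-refl = conv-σ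
  ... | false = prev<σ

  Jgo-≡[] : ∀ σ i {prev} k → length σ ≤ prev → Jgo σ i prev k ≡ []
  Jgo-≡[] σ i zero _ = refl
  Jgo-≡[] σ i {prev} (suc k) σ≤prev
    with tNext i σ prev ≤ᵇ length σ | ℕ.≤ᵇ-reflects-≤ (tNext i σ prev) (length σ)
  ... | false | _ = refl
  ... | true | ofʸ t≤σ = ⊥-elim (ℕ.<⇒≱ (prev<tNext i σ prev) (ℕ.≤-trans t≤σ σ≤prev))

  code∈Jgo : ∀ σ i {prev} k → prev < length σ → length σ ≤ prev + k → code σ ∈ Jgo σ i prev k
  code∈Jgo σ i {prev} zero prev<σ σ≤prev =
    ⊥-elim (ℕ.<⇒≱ prev<σ (subst (_ ≤_) (ℕ.+-identityʳ prev) σ≤prev))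
  code∈Jgo σ i {prev} (suc k) prev<σ σ≤prev+k
    with tNext i σ prev ≤ᵇ length σ | ℕ.≤ᵇ-reflects-≤ (tNext i σ prev) (length σ)
  ... | false | ofⁿ t≰σ = ⊥-elim (t≰σ (tNext-≤ i σ prev<σ))
  ... | true | ofʸ t≤σ with ℕ.m≤n⇒m<n∨m≡n t≤σ
  ...   | inj₁ t<σ = there (code∈Jgo σ (suc i) k t<σ (ℕ.≤-trans σ≤prev+k prev+k≤t+k))
    where
      prev+k≤t+k : prev + suc k ≤ tNext i σ prev + k
      prev+k≤t+k = subst (_≤ tNext i σ prev + k) (sym (ℕ.+-suc prev k))
                         (ℕ.+-monoˡ-≤ k (prev<tNext i σ prev))
  ...   | inj₂ t≡σ = here (cong code (sym (take-all _ σ (ℕ.≤-reflexive (sym t≡σ)))))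

  Jgo-codes : ∀ σ i prev k {x} → x ∈ Jgo σ i prev k → ∃ λ t → x ≡ code (take t σ)
  Jgo-codes σ i prev (suc k) x∈ with tNext i σ prev ≤ᵇ length σ
  Jgo-codes σ i prev (suc k) (here x≡) | true = _ , x≡
  Jgo-codes σ i prev (suc k) (there x∈) | true = Jgo-codes σ (suc i) _ k x∈

  Jgo-length : ∀ σ i {prev} k → prev ≤ length σ → length (Jgo σ i prev k) + prev ≤ length σ
  Jgo-length σ i zero prev≤σ = prev≤σ
  Jgo-length σ i {prev} (suc k) prev≤σ
    with tNext i σ prev ≤ᵇ length σ | ℕ.≤ᵇ-reflects-≤ (tNext i σ prev) (length σ)
  ... | false | _ = prev≤σ
  ... | true | ofʸ t≤σ = ℕ.≤-trans one-more (Jgo-length σ (suc i) k t≤σ)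
    where
      ℓ = length (Jgo σ (suc i) (tNext i σ prev) k)
      one-more : suc (ℓ + prev) ≤ ℓ + tNext i σ prev
      one-more = subst (_≤ ℓ + tNext i σ prev) (ℕ.+-suc ℓ prev)
                       (ℕ.+-monoʳ-≤ ℓ (prev<tNext i σ prev))

  code∈J : ∀ σ → 2 ≤ length σ → code σ ∈ J σ
  code∈J σ 2≤σ = code∈Jgo σ 0 (length σ) 2≤σ (ℕ.m≤n+m (length σ) 1)

  J-jumpLike : JumpLike J
  J-jumpLike = record
    { short⇒[] = λ σ → Jgo-≡[] σ 0 (length σ)
    ; []⇒short = λ σ J≡[] → ℕ.≮⇒≥ (λ 1<σ → x∉[] (subst (code σ ∈_) J≡[] (code∈J σ 1<σ)))
    ; shrinks = shrinks
    ; reflects = reflects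
    }
    where
      x∉[] : ∀ {x : ℕ} → ¬ x ∈ []
      x∉[] ()

      shrinks : ∀ σ → σ ≢ [] → length (J σ) < length σ
      shrinks [] σ≢[] = ⊥-elim (σ≢[] refl)
      shrinks σ@(_ ∷ _) _ =
        subst (_≤ length σ) (ℕ.+-comm _ 1) (Jgo-length σ 0 (length σ) (s≤s z≤n))

      2≤length : ∀ σ → J σ ≢ [] → 2 ≤ length σ
      2≤length σ J≢[] = ℕ.≰⇒> (J≢[] ∘ Jgo-≡[] σ 0 (length σ))

      reflects : ∀ {σ τ} → J σ ⊑⁺ J τ → σ ⊑⁺ τ
      reflects {σ} {τ} (J≢[] , Jσ⊑Jτ)
        with Jgo-codes τ 0 1 (length τ) (∈-mono-⊑ (code∈J σ (2≤length σ J≢[])) Jσ⊑Jτ)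
      ... | t , code≡ = σ≢[] , subst (_⊑ τ) (sym (code-inj code≡)) (take-⊑ t τ)
        where
          σ≢[] : σ ≢ []
          σ≢[] refl = J≢[] refl

module IteratedJumps (conv : Conv) (code : Str → ℕ) (code-inj : Injective _≡_ _≡_ code) where
  open Iterated conv code
  open JumpLikeJ conv code code-inj using (J-jumpLike)

  module Loop (g : ℕ → Str → Str) (g-jumpLike : ∀ n → JumpLike (g n)) where
    private
      module G n = JumpLike (g-jumpLike n)
      I = iterN g

    iterN-⊑⁺-descend : ∀ {X Y m n} → m ≤ n → I n X ⊑⁺ I n Y → I m X ⊑⁺ I m Y
    iterN-⊑⁺-descend {X} {Y} = ≤-descend {λ k → I k X ⊑⁺ I k Y} (λ {k} → G.reflects k)

    iterN-⊑₁-ascend : ∀ {X Y m n} → m ≤ n → I m X ⊑₁ I m Y → I n X ⊑₁ I n Y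
    iterN-⊑₁-ascend {X} {Y} = ≤-ascend {λ k → I k X ⊑₁ I k Y} (λ {k} → G.⊑₁-step k)

    loop-of-[] : ∀ n cur k → g n cur ≡ [] → loop g n cur k ≡ []
    loop-of-[] n [] k _ = refl
    loop-of-[] n (x ∷ xs) zero _ = refl
    loop-of-[] n (x ∷ xs) (suc k) g≡[] rewrite g≡[] = refl

    loop-≡[] : ∀ n cur k → length cur < k → loop g n cur k ≡ [] → g n cur ≡ []
    loop-≡[] n [] k _ _ = G.[]↦[] n
    loop-≡[] n (x ∷ xs) (suc k) _ _ with g n (x ∷ xs)
    loop-≡[] n (x ∷ xs) (suc k) _ _ | [] = refl
    loop-≡[] n (x ∷ xs) (suc k) _ () | _ ∷ _

    loop-∷ : ∀ n cur k {z rest} → loop g n cur k ≡ z ∷ rest →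
             ∃ λ k′ → k ≡ suc k′ × ∃ (λ zs → g n cur ≡ z ∷ zs) × loop g (suc n) (g n cur) k′ ≡ rest
    loop-∷ n [] k ()
    loop-∷ n (x ∷ xs) zero ()
    loop-∷ n (x ∷ xs) (suc k) _ with g n (x ∷ xs)
    loop-∷ n (x ∷ xs) (suc k) () | []
    loop-∷ n (x ∷ xs) (suc k) refl | z ∷ zs = k , refl , (zs , refl) , refl

    loop-shrinks : ∀ n cur k → cur ≢ [] → length (loop g n cur k) < length cur
    loop-shrinks n [] k cur≢[] = ⊥-elim (cur≢[] refl)
    loop-shrinks n (x ∷ xs) zero _ = s≤s z≤n
    loop-shrinks n (x ∷ xs) (suc k) _ with g n (x ∷ xs) | G.shrinks n (x ∷ xs) (λ ())
    ... | [] | _ = s≤s z≤n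
    ... | y ∷ ys | g<cur = ℕ.≤-trans (s≤s (loop-shrinks (suc n) (y ∷ ys) k (λ ()))) g<cur

    fuel-shrinks : ∀ n {cur k z zs} → g n cur ≡ z ∷ zs → length cur < suc k → length (g n cur) < k
    fuel-shrinks n {cur} g≡ cur<k = ℕ.<-≤-trans (G.shrinks n cur cur≢[]) (ℕ.≤-pred cur<k)
      where
        cur≢[] : cur ≢ []
        cur≢[] refl with () ← trans (sym g≡) (G.[]↦[] n)

    -- The entry emitted by the loop just before it stops is the whole of the
    -- last nonempty iterate.
    loop-∷-lastLevel : ∀ n {X Y k k′ z r r′} → length (I n X) < k →
                       loop g n (I n X) k ≡ z ∷ r → loop g n (I n Y) k′ ≡ z ∷ r′ → r ⊑ r′ →
                       ∃ λ m → length (I m X) ≤ 1 × I m X ⊑⁺ I m Y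
    loop-∷-lastLevel n {X} {Y} {k} {k′} {r = []} fuel eX eY _
      with loop-∷ n (I n X) k eX | loop-∷ n (I n Y) k′ eY
    ... | k₁ , refl , (_ , gX) , eX′ | _ , _ , (_ , gY) , _ =
      suc n , short , subst₂ _⊑⁺_ (sym gX) (sym gY)
                        ((λ ()) , short-∷-⊑ (subst (λ w → length w ≤ 1) gX short))
      where
        short : length (g n (I n X)) ≤ 1
        short = G.[]⇒short (suc n) (g n (I n X))
                  (loop-≡[] (suc n) _ k₁ (fuel-shrinks n gX fuel) eX′)
    loop-∷-lastLevel n {X} {Y} {k} {k′} {r = _ ∷ _} fuel eX eY (refl ∷ r⊑r′)
      with loop-∷ n (I n X) k eX | loop-∷ n (I n Y) k′ eY
    ... | _ , refl , (_ , gX) , eX′ | _ , refl , _ , eY′ =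
      loop-∷-lastLevel (suc n) (fuel-shrinks n gX fuel) eX′ eY′ r⊑r′

    L : Str → Str
    L σ = loop g 0 σ (suc (length σ))

    loop-⊑⁺-lastLevel : ∀ {X Y} → L X ⊑⁺ L Y → ∃ λ m → length (I m X) ≤ 1 × I m X ⊑⁺ I m Y
    loop-⊑⁺-lastLevel {X} {Y} p with ⊑⁺-∷ p
    ... | _ , _ , _ , eX , eY , r⊑r′ = loop-∷-lastLevel 0 {X} {Y} ℕ.≤-refl eX eY r⊑r′

    loop-jumpLike : JumpLike L
    loop-jumpLike = record
      { short⇒[] = λ ρ ρ≤1 → loop-of-[] 0 ρ _ (G.short⇒[] 0 ρ ρ≤1)
      ; []⇒short = λ ρ L≡[] → G.[]⇒short 0 ρ (loop-≡[] 0 ρ _ ℕ.≤-refl L≡[])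
      ; shrinks = λ ρ → loop-shrinks 0 ρ _
      ; reflects = λ {X} {Y} p → let (m , _ , m-⊑⁺) = loop-⊑⁺-lastLevel {X} {Y} p in
          iterN-⊑⁺-descend {X} {Y} {n = m} z≤n m-⊑⁺
      }

  Jω-jumpLike : ∀ α → JumpLike (Jω α)
  Jω-jumpLike zero = J-jumpLike
  Jω-jumpLike (lim f) = Loop.loop-jumpLike (Jω ∘ f) (Jω-jumpLike ∘ f)

  module LoopJω f = Loop (Jω ∘ f) (Jω-jumpLike ∘ f)

  Jaddr-reflects : ∀ α a {X Y} → Jaddr α a X ⊑⁺ Jaddr α a Y → X ⊑⁺ Y
  Jaddr-reflects α [] = JumpLike.reflects (Jω-jumpLike α)
  Jaddr-reflects zero (_ ∷ _) p = p
  Jaddr-reflects (lim f) (n ∷ ns) {X} {Y} p =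
    LoopJω.iterN-⊑⁺-descend f {X} {Y} {n = n} z≤n (Jaddr-reflects (f n) ns p)

  Jaddr-short : ∀ α a {X Y} → X ⊑₁ Y → Jaddr α a X ⊑ Jaddr α a Y
  Jaddr-short α [] {X} (X≤1 , _) rewrite JumpLike.short⇒[] (Jω-jumpLike α) X X≤1 = []
  Jaddr-short zero (_ ∷ _) = proj₂
  Jaddr-short (lim f) (n ∷ ns) {X} {Y} p =
    Jaddr-short (f n) ns (LoopJω.iterN-⊑₁-ascend f {X} {Y} {n = n} z≤n p)

  Jaddr-⊑-below : ∀ α {a b X Y} → b ⊴ a → Jaddr α a X ⊑⁺ Jaddr α a Y → Jaddr α b X ⊑ Jaddr α b Y
  Jaddr-⊑-below α {b = []} ⊴-[] = proj₂
  Jaddr-⊑-below zero {b = _ ∷ _} ⊴-[] = proj₂ ∘ JumpLike.reflects J-jumpLike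
  Jaddr-⊑-below (lim f) {b = m ∷ ms} {X} {Y} ⊴-[] p
    with LoopJω.loop-⊑⁺-lastLevel f {X} {Y} p
  ... | k , k-short , k-⊑⁺ with ℕ.<-≤-connex m k
  ...   | inj₁ m<k = Jaddr-⊑-below (f m) {b = ms} ⊴-[] (LoopJω.iterN-⊑⁺-descend f {X} {Y} m<k k-⊑⁺)
  ...   | inj₂ k≤m =
    Jaddr-short (f m) ms (LoopJω.iterN-⊑₁-ascend f {X} {Y} k≤m (k-short , proj₂ k-⊑⁺))
  Jaddr-⊑-below zero (⊴-< _) = proj₂
  Jaddr-⊑-below zero (⊴-∷ _) = proj₂
  Jaddr-⊑-below (lim f) {n ∷ ns} {_ ∷ ms} {X} {Y} (⊴-< m<n) p =
    Jaddr-⊑-below (f _) {b = ms} ⊴-[]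
      (LoopJω.iterN-⊑⁺-descend f {X} {Y} m<n (Jaddr-reflects (f n) ns p))
  Jaddr-⊑-below (lim f) (⊴-∷ b⊴a) = Jaddr-⊑-below (f _) b⊴a

open IteratedJumps using (Jaddr-⊑-below)

lemma7p5 : (conv : Conv) → ConvMonotone conv →
           (code : Str → ℕ) → Injective _≡_ _≡_ code →
           (η : Ord) → IsSystem η →
           let open Iterated conv code in
           ∀ (s t : ℕ) → s < t →
           ∀ (γ ξ : Idx η) → idxVal γ <o idxVal ξ → idxVal ξ ≤o ω^ ⟦ η ⟧ →
           ∇ ξ s ≢ [] → ∇ ξ s ⊑ ∇ ξ t → ∇ γ s ⊑ ∇ γ t
lemma7p5 _ _ _ _ _ _ s t s<t Iterated.one _ _ _ _ _ = replicate⁺ (ℕ.<⇒≤ s<t) refl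
lemma7p5 _ _ _ _ η _ _ _ _ (Iterated.oneplus b _) Iterated.one γ<ξ _ _ _ =
  ⊥-elim (<o⇒≱ γ<ξ (x≼x+y (bs bz) (addrVal η b)))
lemma7p5 conv _ code code-inj η (mono , _) s t _ (Iterated.oneplus b b∈) (Iterated.oneplus a a∈)
         γ<ξ _ ∇ξ≢[] ∇ξ⊑
  with ⊴-or-≼ mono a∈ b∈
... | inj₁ b⊴a = Jaddr-⊑-below conv code code-inj η b⊴a (∇ξ≢[] , ∇ξ⊑)
... | inj₂ a≼b = ⊥-elim (<o⇒≱ γ<ξ (+-monoʳ-≼ (bs bz) a≼b))
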